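{- For every (finite, simple, undirected) tree $T$ we have $\gamma_R(T) = \bar{\gamma}_R(T)$.
   Context: For a graph $G$ and a vertex $v$, $N[v]$ denotes the closed neighbourhood of $v$ (the set of neighbours of $v$ together with $v$). A Roman dominating function of $G$ is a map $f\colon V(G)\to\{0,1,2\}$ such that every vertex $v$ with $f(v)=0$ has a neighbour $u$ with $f(u)=2$; its weight is $\sum_{v\in V(G)} f(v)$, and $\gamma_R(G)$ (the Roman domination number) is the minimum weight of a Roman dominating function of $G$. A two neighbour packing of $G$ is a set $A\subseteq V(G)$ such that $|N[v]\cap A|\le 2$ for every $v\in V(G)$; $\bar{\gamma}_R(G)$ (the two neighbour packing number) is the maximum size of a two neighbour packing of $G$. -}

module Defs where

open import Data.Nat using (ℕ; zero; suc; _+_; _≤_; _<_)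
open import Data.Fin using (Fin)
open import Data.Bool using (Bool; true; false; T; _∨_; _∧_)
open import Data.List using (List; []; _∷_; length; _++_)
open import Data.Unit using (⊤)
open import Data.Bool using (if_then_else_)
import Data.Fin as Fin
open import Data.List.Relation.Unary.Unique.Propositional using (Unique)
open import Data.Product using (Σ; ∃; _×_; _,_)
open import Data.Empty using (⊥)
open import Relation.Nullary using (¬_)
open import Relation.Binary.PropositionalEquality using (_≡_)
open import Relation.Binary.Construct.Closure.ReflexiveTransitive using (Star)
open import Data.Fin.Properties using (_≟_)
open import Relation.Nullary.Decidable using (⌊_⌋)

record Graph (n : ℕ) : Set where
  field
    adj   : Fin n → Fin n → Bool
    sym   : ∀ u v → adj u v ≡ adj v u
    irrefl : ∀ v → adj v v ≡ false

module _ {n : ℕ} (G : Graph n) where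
  open Graph G

  Adj : Fin n → Fin n → Set
  Adj u v = T (adj u v)

  Connected : Set
  Connected = ∀ u v → Star Adj u v

  IsWalk : List (Fin n) → Set
  IsWalk [] = ⊥
  IsWalk (x ∷ []) = ⊤
  IsWalk (x ∷ y ∷ xs) = Adj x y × IsWalk (y ∷ xs)

  record Cycle : Set where
    field
      first  : Fin n
      rest   : List (Fin n)
      last   : Fin n
      len≥3  : 3 ≤ length rest + 2
      walk   : IsWalk (first ∷ (rest ++ (last ∷ [])))
      closes : Adj last first
      unique : Unique (first ∷ (rest ++ (last ∷ [])))

  Acyclic : Set
  Acyclic = ¬ Cycle

  IsTree : Set
  IsTree = (0 < n) × Connected × Acyclic

  count : (Fin n → Bool) → ℕ
  count p = go n (λ i → i) where
    go : (m : ℕ) → (Fin m → Fin n) → ℕ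
    go zero    f = 0
    go (suc m) f = (if p (f Fin.zero) then 1 else 0) + go m (λ i → f (Fin.suc i))

  sumV : (Fin n → ℕ) → ℕ
  sumV g = go n (λ i → i) where
    go : (m : ℕ) → (Fin m → Fin n) → ℕ
    go zero    f = 0
    go (suc m) f = g (f Fin.zero) + go m (λ i → f (Fin.suc i))

  IsRDF : (Fin n → ℕ) → Set
  IsRDF f = (∀ v → f v ≤ 2) × (∀ v → f v ≡ 0 → ∃ λ u → Adj v u × f u ≡ 2)

  weight : (Fin n → ℕ) → ℕ
  weight f = sumV f

  RomanDominationNumber : ℕ → Set
  RomanDominationNumber k =
    (∃ λ f → IsRDF f × weight f ≡ k) × (∀ f → IsRDF f → k ≤ weight f)

  inN : Fin n → Fin n → Bool
  inN v u = ⌊ v ≟ u ⌋ ∨ adj v u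

  IsTwoNeighbourPacking : (Fin n → Bool) → Set
  IsTwoNeighbourPacking A = ∀ v → count (λ u → inN v u ∧ A u) ≤ 2

  size : (Fin n → Bool) → ℕ
  size A = count A

  TwoNeighbourPackingNumber : ℕ → Set
  TwoNeighbourPackingNumber k =
    (∃ λ A → IsTwoNeighbourPacking A × size A ≡ k)
    × (∀ A → IsTwoNeighbourPacking A → size A ≤ k)

{-# OPTIONS --safe #-}
module Submission where

-- Weak duality: charge each vertex of a two neighbour packing B to a vertex of its closed
-- neighbourhood with positive label under a Roman dominating function f (to itself unless its
-- label is 0, and then to a neighbour labelled 2).  A vertex labelled 1 receives at most one
-- charge and a vertex u labelled 2 at most |N[u] ∩ B| ≤ 2, so |B| ≤ w(f).
--
-- Equality on forests comes from a greedy primal-dual construction for a weighted version of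
-- both problems, in which only the vertices of a demand set must be dominated (and may be
-- packed) and each vertex has a capacity that bounds its neighbourhood in the packing and is
-- also the price of labelling it 2.  A nonempty forest has a vertex v of degree at most one
-- (the end of a maximal path); v is removed, the demand or capacity of its neighbour is
-- adjusted, and v's label and membership in the packing are chosen so that the cost of the
-- labelling never exceeds the size of the packing.

open import Defs
open import Data.Nat using (ℕ; zero; suc; _+_; _*_; _≤_; z≤n; s≤s)
open import Data.Nat.Properties
  using (+-*-semiring; +-commutativeSemigroup; +-assoc; +-comm; +-identityʳ; +-cancelʳ-≡;
         +-mono-≤; +-monoˡ-≤; +-monoʳ-≤; ≤-refl; ≤-trans; ≤-reflexive; ≤-antisym; m≤m+n; m≤n+m; suc-injective; module ≤-Reasoning)
open import Data.Fin using (Fin; zero; suc)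
open import Data.Fin.Properties using (_≟_; any?)
import Data.Fin.Properties as Fin
open import Data.Bool using (Bool; true; false; T; _∧_; not; if_then_else_)
open import Data.Bool.Properties using (T-∧; T-≡; T-not-≡; ∧-zeroʳ)
open import Data.List using (List; []; _∷_; _++_; [_]; length)
open import Data.List.Properties using (++-assoc)
open import Data.List.Relation.Unary.All using (All; []; _∷_)
import Data.List.Relation.Unary.All.Properties as All
open import Data.List.Relation.Unary.Any using (here; there)
open import Data.List.Relation.Unary.Unique.Propositional using (Unique; []; _∷_)
open import Data.List.Membership.Propositional using (_∈_; _∉_)
open import Data.List.Membership.Propositional.Properties using (∈-∃++)
open import Data.Vec.Functional using (updateAt)
open import Data.Vec.Functional.Properties using (updateAt-updates; updateAt-minimal)
open import Data.Product using (∃; ∃₂; _×_; _,_; proj₁; proj₂)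
open import Data.Sum using (_⊎_; inj₁; inj₂)
open import Data.Unit using (tt)
open import Data.Empty using (⊥-elim)
open import Function using (_∘_; const; case_of_)
open import Function.Bundles using (Equivalence; mk⇔)
open import Relation.Nullary using (¬_; does; yes; no; contradiction; ¬?; _×-dec_)
open import Relation.Nullary.Decidable using (dec-true; dec-false; does-⇔; T?)
open import Relation.Binary.PropositionalEquality
  using (_≡_; _≢_; refl; sym; trans; cong; cong₂; subst; subst₂; module ≡-Reasoning)
open import Algebra.Properties.Semiring.Sum +-*-semiring
  using (sum; sum-cong-≗; ∑-distrib-+; ∑-comm; *-distribˡ-sum)
open import Algebra.Properties.CommutativeSemigroup +-commutativeSemigroup
  using (x∙yz≈y∙xz; xy∙z≈x∙zy; xy∙z≈xz∙y)

-- Finite sums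

bit : Bool → ℕ
bit b = if b then 1 else 0

bit≤1 : ∀ b → bit b ≤ 1
bit≤1 true  = ≤-refl
bit≤1 false = z≤n

bit≤ : ∀ {b x} → (b ≡ true → 1 ≤ x) → bit b ≤ x
bit≤ {true}  1≤x = 1≤x refl
bit≤ {false} _   = z≤n

sum-mono-≤ : ∀ {n} {g h : Fin n → ℕ} → (∀ i → g i ≤ h i) → sum g ≤ sum h
sum-mono-≤ {zero}  g≤h = z≤n
sum-mono-≤ {suc n} g≤h = +-mono-≤ (g≤h zero) (sum-mono-≤ (g≤h ∘ suc))

term≤sum : ∀ {n} (g : Fin n → ℕ) i → g i ≤ sum g
term≤sum g zero    = m≤m+n _ _
term≤sum g (suc i) = ≤-trans (term≤sum (g ∘ suc) i) (m≤n+m _ _)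

sum-zero : ∀ {n} {g : Fin n → ℕ} → (∀ i → g i ≡ 0) → sum g ≡ 0
sum-zero {zero}  g≡0 = refl
sum-zero {suc n} g≡0 = cong₂ _+_ (g≡0 zero) (sum-zero (g≡0 ∘ suc))

sum-agree-off : ∀ {n} {g h : Fin n → ℕ} i → (∀ j → j ≢ i → g j ≡ h j) → sum g + h i ≡ g i + sum h
sum-agree-off {suc n} {g} {h} zero g≗h = begin
  g zero + sum (g ∘ suc) + h zero       ≡⟨ xy∙z≈x∙zy (g zero) _ _ ⟩
  g zero + (h zero + sum (g ∘ suc))     ≡⟨ cong (λ x → g zero + (h zero + x)) (sum-cong-≗ λ j → g≗h (suc j) λ ()) ⟩
  g zero + sum h                        ∎
  where open ≡-Reasoning
sum-agree-off {suc n} {g} {h} (suc i) g≗h = begin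
  g zero + sum (g ∘ suc) + h (suc i)    ≡⟨ +-assoc (g zero) _ _ ⟩
  g zero + (sum (g ∘ suc) + h (suc i))  ≡⟨ cong (g zero +_) (sum-agree-off i g≗h-off-i) ⟩
  g zero + (g (suc i) + sum (h ∘ suc))  ≡⟨ x∙yz≈y∙xz (g zero) (g (suc i)) _ ⟩
  g (suc i) + (g zero + sum (h ∘ suc))  ≡⟨ cong (λ x → g (suc i) + (x + sum (h ∘ suc))) (g≗h zero λ ()) ⟩
  g (suc i) + sum h                     ∎
  where
  open ≡-Reasoning
  g≗h-off-i : ∀ j → j ≢ i → g (suc j) ≡ h (suc j)
  g≗h-off-i j j≢i = g≗h (suc j) (j≢i ∘ Fin.suc-injective)

sum-split : ∀ {n} {g h : Fin n → ℕ} i → h i ≡ 0 → (∀ j → j ≢ i → g j ≡ h j) → sum g ≡ g i + sum h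
sum-split {g = g} {h} i hi≡0 g≗h = begin
  sum g          ≡⟨ +-identityʳ (sum g) ⟨
  sum g + 0      ≡⟨ cong (sum g +_) hi≡0 ⟨
  sum g + h i    ≡⟨ sum-agree-off i g≗h ⟩
  g i + sum h    ∎
  where open ≡-Reasoning

sum-single : ∀ {n} (g : Fin n → ℕ) i → (∀ j → j ≢ i → g j ≡ 0) → sum g ≡ g i
sum-single {n} g i g≡0 = begin
  sum g                    ≡⟨ sum-split i refl g≡0 ⟩
  g i + sum {n} (const 0)  ≡⟨ cong (g i +_) (sum-zero {n} λ _ → refl) ⟩
  g i + 0                  ≡⟨ +-identityʳ (g i) ⟩
  g i                      ∎
  where open ≡-Reasoning

-- `sumV` and `count` recurse through where-bound helpers that cannot be named here;
-- each `_` below is solved by unification to such a helper, exposing its recursion.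
private
  mutual
    sumV-go : ∀ {n} → Graph n → (Fin n → ℕ) → ∀ m → (Fin m → Fin n) → ℕ
    sumV-go = _

    sumV-unfold : ∀ {k} (G : Graph (suc k)) g → sumV G g ≡ g zero + sumV-go G g k (λ i → suc i)
    sumV-unfold {k} G g with suc k | G | g | (λ (i : Fin k) → suc {k} i) | g zero
    ... | _ | _ | _ | _ | _ = refl

  mutual
    count-go : ∀ {n} → Graph n → (Fin n → Bool) → ∀ m → (Fin m → Fin n) → ℕ
    count-go = _

    count-unfold : ∀ {k} (G : Graph (suc k)) p → count G p ≡ bit (p zero) + count-go G p k (λ i → suc i)
    count-unfold {k} G p with suc k | G | p | (λ (i : Fin k) → suc {k} i) | p zero
    ... | _ | _ | _ | _ | _ = refl

  sumV-go≡sum : ∀ {n} (G : Graph n) g m (f : Fin m → Fin n) → sumV-go G g m f ≡ sum (g ∘ f)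
  sumV-go≡sum G g zero    f = refl
  sumV-go≡sum G g (suc m) f = cong (g (f zero) +_) (sumV-go≡sum G g m (f ∘ suc))

  count-go≡sum : ∀ {n} (G : Graph n) p m (f : Fin m → Fin n) → count-go G p m f ≡ sum (bit ∘ p ∘ f)
  count-go≡sum G p zero    f = refl
  count-go≡sum G p (suc m) f = cong (bit (p (f zero)) +_) (count-go≡sum G p m (f ∘ suc))

sumV≡sum : ∀ {n} (G : Graph n) g → sumV G g ≡ sum g
sumV≡sum {zero}  G g = refl
sumV≡sum {suc k} G g = trans (sumV-unfold G g) (cong (g zero +_) (sumV-go≡sum G g k suc))

count≡sum : ∀ {n} (G : Graph n) p → count G p ≡ sum (bit ∘ p)
count≡sum {zero}  G p = refl
count≡sum {suc k} G p = trans (count-unfold G p) (cong (bit (p zero) +_) (count-go≡sum G p k suc))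

isOne isTwo : ℕ → Bool
isOne 1 = true
isOne _ = false
isTwo 2 = true
isTwo _ = false

isTwo⇒≡2 : ∀ {k} → isTwo k ≡ true → k ≡ 2
isTwo⇒≡2 {2} _ = refl
isTwo⇒≡2 {0} ()
isTwo⇒≡2 {1} ()
isTwo⇒≡2 {suc (suc (suc _))} ()

Unique-++⁻ˡ : ∀ {A : Set} (xs : List A) {ys} → Unique (xs ++ ys) → Unique xs
Unique-++⁻ˡ []       _          = []
Unique-++⁻ˡ (x ∷ xs) (x∉ ∷ xs!) = All.++⁻ˡ xs x∉ ∷ Unique-++⁻ˡ xs xs!

¬T⇒≡false : ∀ {b} → ¬ T b → b ≡ false
¬T⇒≡false {true}  ¬b = contradiction _ ¬b
¬T⇒≡false {false} _  = refl

_[_]≔_ : ∀ {A : Set} {n} → (Fin n → A) → Fin n → A → Fin n → A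
g [ i ]≔ x = updateAt g i (const x)

module _ {n : ℕ} (G : Graph n) where
  open Graph G using (adj; irrefl)
  open import Data.List.Membership.DecPropositional (_≟_ {n}) using (_∈?_)

  ∣_∣ : (Fin n → Bool) → ℕ
  ∣ P ∣ = sum (bit ∘ P)

  N[_]∩_ : Fin n → (Fin n → Bool) → Fin n → Bool
  (N[ v ]∩ A) u = inN G v u ∧ A u

  Adj-sym : ∀ {u v} → Adj G u v → Adj G v u
  Adj-sym {u} {v} = subst T (Graph.sym G u v)

  Adj⇒≢ : ∀ {u v} → Adj G u v → u ≢ v
  Adj⇒≢ {u} uv refl = subst T (irrefl u) uv

  inN-refl : ∀ v → inN G v v ≡ true
  inN-refl v with v ≟ v
  ... | yes _   = refl
  ... | no v≢v = contradiction refl v≢v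

  inN-≢ : ∀ {u v} → u ≢ v → inN G u v ≡ adj u v
  inN-≢ {u} {v} u≢v with u ≟ v
  ... | yes u≡v = contradiction u≡v u≢v
  ... | no _    = refl

  Adj⇒inN : ∀ {u v} → Adj G u v → inN G u v ≡ true
  Adj⇒inN uv = trans (inN-≢ (Adj⇒≢ uv)) (Equivalence.to T-≡ uv)

  T-inN : ∀ {v z} → T (inN G v z) → v ≡ z ⊎ Adj G v z
  T-inN {v} {z} vz with v ≟ z
  ... | yes v≡z = inj₁ v≡z
  ... | no _    = inj₂ vz

  -- Weak duality

  charge≤label : ∀ {k} b c → k ≤ 2 → c ≤ 2 → bit (isOne k ∧ b) + bit (isTwo k) * c ≤ k
  charge≤label {0}             b c _ _   = z≤n
  charge≤label {1}             b c _ _   = subst (_≤ 1) (sym (+-identityʳ (bit b))) (bit≤1 b)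
  charge≤label {2}             b c _ c≤2 = subst (_≤ 2) (sym (+-identityʳ c)) c≤2
  charge≤label {suc (suc (suc _))} b c (s≤s (s≤s ())) _

  module _ {g : Fin n → ℕ} {B : Fin n → Bool} where
    private
      charge : Fin n → Fin n → ℕ
      charge u v = bit (isTwo (g u)) * bit ((N[ u ]∩ B) v)

      charged : ∀ u v → g u ≡ 2 → inN G u v ≡ true → B v ≡ true → 1 ≤ sum (λ w → charge w v)
      charged u v gu≡2 uv Bv = subst (_≤ sum (λ w → charge w v)) term≡1 (term≤sum (λ w → charge w v) u)
        where
        term≡1 : charge u v ≡ 1
        term≡1 rewrite gu≡2 | uv | Bv = refl

    covered : IsRDF G g → ∀ v → bit (B v) ≤ bit (isOne (g v) ∧ B v) + sum (λ u → charge u v)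
    covered (g≤2 , dominated) v with g v in gv
    ... | 0 = bit≤ λ Bv →
      let u , vu , gu≡2 = dominated v gv
      in charged u v gu≡2 (Adj⇒inN (Adj-sym vu)) Bv
    ... | 1 = m≤m+n (bit (B v)) _
    ... | 2 = bit≤ λ Bv → ≤-trans (charged v v gv (inN-refl v) Bv) (m≤n+m _ _)
    ... | suc (suc (suc _)) = contradiction (subst (_≤ 2) gv (g≤2 v)) λ { (s≤s (s≤s ())) }

    packing≤weight : IsRDF G g → IsTwoNeighbourPacking G B → size G B ≤ weight G g
    packing≤weight rdf@(g≤2 , _) packing =
      subst₂ _≤_ (sym (count≡sum G B)) (sym (sumV≡sum G g)) (begin
        ∣ B ∣
          ≤⟨ sum-mono-≤ (covered rdf) ⟩
        sum (λ v → ones v + sum (λ u → charge u v))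
          ≡⟨ ∑-distrib-+ ones (λ v → sum (λ u → charge u v)) ⟩
        sum ones + sum (λ v → sum (λ u → charge u v))
          ≡⟨ cong (sum ones +_) (∑-comm charge) ⟨
        sum ones + sum (λ u → sum (charge u))
          ≡⟨ cong (sum ones +_) (sum-cong-≗ λ u → *-distribˡ-sum (bit (isTwo (g u))) (bit ∘ N[ u ]∩ B)) ⟨
        sum ones + sum twos
          ≡⟨ ∑-distrib-+ ones twos ⟨
        sum (λ u → ones u + twos u)
          ≤⟨ sum-mono-≤ (λ u → charge≤label (B u) _ (g≤2 u) (packed u)) ⟩
        sum g ∎)
      where
      open ≤-Reasoning
      ones twos : Fin n → ℕ
      ones u = bit (isOne (g u) ∧ B u)
      twos u = bit (isTwo (g u)) * ∣ N[ u ]∩ B ∣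
      packed : ∀ u → ∣ N[ u ]∩ B ∣ ≤ 2
      packed u = subst (_≤ 2) (count≡sum G _) (packing u)

  -- Pendant vertices of forests

  IsWalk-++⁻ˡ : ∀ x xs {ys} → IsWalk G (x ∷ xs ++ ys) → IsWalk G (x ∷ xs)
  IsWalk-++⁻ˡ x []       _           = tt
  IsWalk-++⁻ˡ x (y ∷ xs) (xy , walk) = xy , IsWalk-++⁻ˡ y xs walk

  -- Otherwise x q ⋯ w x would be a cycle.
  no-chord : Acyclic G → ∀ {x q w rest} → IsWalk G (x ∷ q ∷ rest) → Unique (x ∷ q ∷ rest) →
             w ∈ rest → ¬ Adj G x w
  no-chord acyclic {x} {q} {w} walk unique w∈rest xw with ∈-∃++ w∈rest
  ... | pre , post , refl = acyclic record
    { first  = x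
    ; rest   = q ∷ pre
    ; last   = w
    ; len≥3  = s≤s (m≤n+m 2 (length pre))
    ; walk   = IsWalk-++⁻ˡ x (q ∷ pre ++ [ w ]) (subst (IsWalk G) reassoc walk)
    ; closes = Adj-sym xw
    ; unique = Unique-++⁻ˡ (x ∷ q ∷ pre ++ [ w ]) (subst Unique reassoc unique)
    }
    where
    reassoc : x ∷ q ∷ pre ++ w ∷ post ≡ x ∷ q ∷ (pre ++ [ w ]) ++ post
    reassoc = cong (λ l → x ∷ q ∷ l) (sym (++-assoc pre [ w ] post))

  data Pendant (S : Fin n → Bool) (v : Fin n) : Set where
    isolated : (∀ w → T (S w) → ¬ Adj G v w) → Pendant S v
    leaf     : ∀ {u} → T (S u) → Adj G v u → (∀ w → T (S w) → Adj G v w → w ≡ u) → Pendant S v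

  unvisited : List (Fin n) → ℕ
  unvisited xs = ∣ (λ z → not (does (z ∈? xs))) ∣

  unvisited-∷ : ∀ {w xs} → w ∉ xs → suc (unvisited (w ∷ xs)) ≡ unvisited xs
  unvisited-∷ {w} {xs} w∉xs = sym (begin
    unvisited xs                      ≡⟨ sum-split w off-w∷xs-at-w same-off-w ⟩
    off xs w + unvisited (w ∷ xs)     ≡⟨ cong (λ b → bit (not b) + unvisited (w ∷ xs)) (dec-false (w ∈? xs) w∉xs) ⟩
    suc (unvisited (w ∷ xs))          ∎)
    where
    open ≡-Reasoning
    off : List (Fin n) → Fin n → ℕ
    off ys z = bit (not (does (z ∈? ys)))
    off-w∷xs-at-w : off (w ∷ xs) w ≡ 0
    off-w∷xs-at-w = cong (bit ∘ not) (dec-true (w ∈? (w ∷ xs)) (here refl))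
    same-off-w : ∀ z → z ≢ w → off xs z ≡ off (w ∷ xs) z
    same-off-w z z≢w = cong (bit ∘ not) (does-⇔ (mk⇔ there drop-w) (z ∈? xs) (z ∈? (w ∷ xs)))
      where
      drop-w : z ∈ w ∷ xs → z ∈ xs
      drop-w (here z≡w)   = contradiction z≡w z≢w
      drop-w (there z∈xs) = z∈xs

  module _ (acyclic : Acyclic G) {S : Fin n → Bool} where

    end-pendant : ∀ {x} xs → IsWalk G (x ∷ xs) → Unique (x ∷ xs) → All (T ∘ S) (x ∷ xs) →
                  (∀ w → T (S w) → Adj G x w → w ∈ x ∷ xs) → Pendant S x
    end-pendant [] _ _ _ on-path = isolated λ w w∈S xw → case on-path w w∈S xw of λ where
      (here w≡x) → Adj⇒≢ xw (sym w≡x)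
    end-pendant {x} (q ∷ rest) walk@(xq , _) unique (_ ∷ q∈S ∷ _) on-path = leaf q∈S xq only-q
      where
      only-q : ∀ w → T (S w) → Adj G x w → w ≡ q
      only-q w w∈S xw with on-path w w∈S xw
      ... | here w≡x             = contradiction (sym w≡x) (Adj⇒≢ xw)
      ... | there (here w≡q)     = w≡q
      ... | there (there w∈rest) = contradiction xw (no-chord acyclic walk unique w∈rest)

    -- Grow a path inside S at its end until that end has no S-neighbour off the path.
    pendant-search : ∀ k x xs → IsWalk G (x ∷ xs) → Unique (x ∷ xs) → All (T ∘ S) (x ∷ xs) →
                     unvisited (x ∷ xs) ≡ k → ∃ λ v → T (S v) × Pendant S v
    pendant-search k x xs walk unique inside _
      with any? (λ w → T? (S w) ×-dec T? (adj x w) ×-dec ¬? (w ∈? (x ∷ xs)))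
    pendant-search k x xs walk unique inside@(x∈S ∷ _) _ | no stuck =
      x , x∈S , end-pendant xs walk unique inside on-path
      where
      on-path : ∀ w → T (S w) → Adj G x w → w ∈ x ∷ xs
      on-path w w∈S xw with w ∈? (x ∷ xs)
      ... | yes w∈ = w∈
      ... | no w∉  = contradiction (w , w∈S , xw , w∉) stuck
    pendant-search zero x xs _ _ _ unvisited≡0 | yes (w , _ , _ , w∉) =
      contradiction (trans (unvisited-∷ w∉) unvisited≡0) λ ()
    pendant-search (suc k) x xs walk unique inside unvisited≡k | yes (w , w∈S , xw , w∉) =
      pendant-search k w (x ∷ xs) (Adj-sym xw , walk) (All.¬Any⇒All¬ _ w∉ ∷ unique) (w∈S ∷ inside)
        (suc-injective (trans (unvisited-∷ w∉) unvisited≡k))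

    pendant-exists : ∀ {s} → T (S s) → ∃ λ v → T (S v) × Pendant S v
    pendant-exists {s} s∈S = pendant-search _ s [] tt ([] ∷ []) (s∈S ∷ []) refl

  -- Strong duality on forests

  _∖N_ : (Fin n → Bool) → Fin n → Fin n → Bool
  (d ∖N v) z = d z ∧ not (adj v z)

  ∖N-⊆ : ∀ {d v w} → T ((d ∖N v) w) → T (d w)
  ∖N-⊆ = proj₁ ∘ Equivalence.to T-∧

  ∖N-¬Adj : ∀ {d v w} → T ((d ∖N v) w) → ¬ Adj G v w
  ∖N-¬Adj d′w = subst T (Equivalence.to T-not-≡ (proj₂ (Equivalence.to T-∧ d′w)))

  ∖N-dropped : ∀ {d v w} → T (d w) → ¬ T ((d ∖N v) w) → Adj G v w
  ∖N-dropped {d} {v} {w} dw ¬d′w with T? (adj v w)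
  ... | yes vw  = vw
  ... | no ¬vw = contradiction (Equivalence.from T-∧ (dw , Equivalence.from T-not-≡ (¬T⇒≡false ¬vw))) ¬d′w

  module _ {v : Fin n} {A : Fin n → Bool} (Av≡false : A v ≡ false) where
    private
      other-neighbour : ∀ {z} → T ((N[ v ]∩ A) z) → T (A z) × Adj G v z
      other-neighbour {z} t with Equivalence.to T-∧ t
      ... | vz , Az with T-inN {v} {z} vz
      ... | inj₁ refl = ⊥-elim (subst T Av≡false Az)
      ... | inj₂ adj  = Az , adj

    nbhd-empty : (∀ z → T (A z) → ¬ Adj G v z) → ∣ N[ v ]∩ A ∣ ≡ 0
    nbhd-empty none = sum-zero λ z → cong bit (¬T⇒≡false λ t → let Az , vz = other-neighbour t in none z Az vz)

    nbhd-single : ∀ {u} → (∀ z → T (A z) → Adj G v z → z ≡ u) → ∣ N[ v ]∩ A ∣ ≤ 1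
    nbhd-single {u} only-u = subst (_≤ 1) (sym (sum-single _ u others)) (bit≤1 _)
      where
      others : ∀ z → z ≢ u → bit ((N[ v ]∩ A) z) ≡ 0
      others z z≢u = cong bit (¬T⇒≡false λ t → let Az , vz = other-neighbour t in z≢u (only-u z Az vz))

  price : ℕ → ℕ → ℕ
  price c 0             = 0
  price c 1             = 1
  price c (suc (suc _)) = c

  price-suc : ∀ j k → k ≤ 2 → price (suc j) k ≡ bit (isTwo k) + price j k
  price-suc j 0 _ = refl
  price-suc j 1 _ = refl
  price-suc j 2 _ = refl
  price-suc j (suc (suc (suc _))) (s≤s (s≤s ()))

  -- The weighted problems on the vertex set S with demand d and capacity c: a labelling
  -- must dominate the demanded vertices within G[S], label 2 at z costs c z, and a packing
  -- A ⊆ S ∩ d may meet N[z] in at most c z vertices.  S = d = V with c = 2 is the original pair.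
  cost : (Fin n → Bool) → (Fin n → ℕ) → (Fin n → ℕ) → ℕ
  cost S c f = sum (λ z → if S z then price (c z) (f z) else 0)

  record Cover (S d : Fin n → Bool) (f : Fin n → ℕ) : Set where
    field
      bounded   : ∀ v → f v ≤ 2
      dominated : ∀ v → T (S v) → T (d v) → f v ≡ 0 → ∃ λ u → T (S u) × Adj G v u × f u ≡ 2

  record Packing (S d : Fin n → Bool) (c : Fin n → ℕ) (A : Fin n → Bool) : Set where
    field
      demanded : ∀ v → T (A v) → T (S v) × T (d v)
      within   : ∀ v → T (S v) → ∣ N[ v ]∩ A ∣ ≤ c v

  record TightPair (S d : Fin n → Bool) (c : Fin n → ℕ) : Set where
    field
      f       : Fin n → ℕ
      A       : Fin n → Bool
      cover   : Cover S d f
      packing : Packing S d c A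
      tight   : cost S c f ≤ ∣ A ∣

  empty-pair : ∀ {S d c} → (∀ v → ¬ T (S v)) → TightPair S d c
  empty-pair {S} {c = c} S-empty = record
    { f       = const 0
    ; A       = const false
    ; cover   = record { bounded = λ _ → z≤n ; dominated = λ v v∈S → contradiction v∈S (S-empty v) }
    ; packing = record { demanded = λ _ () ; within = λ v _ → subst (_≤ c v) (sym nothing-packed) z≤n }
    ; tight   = subst (_≤ ∣ const false ∣) (sym nothing-paid) z≤n
    }
    where
    nothing-packed : ∀ {v} → ∣ N[ v ]∩ const false ∣ ≡ 0
    nothing-packed {v} = sum-zero λ z → cong bit (∧-zeroʳ (inN G v z))
    nothing-paid : cost S c (const 0) ≡ 0
    nothing-paid = sum-zero λ z → if-zero (S z)
      where
      if-zero : ∀ b → (if b then 0 else 0) ≡ 0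
      if-zero true  = refl
      if-zero false = refl

  cost-lower : ∀ {S c f u j} → T (S u) → c u ≡ suc j → f u ≤ 2 →
               cost S c f ≡ bit (isTwo (f u)) + cost S (c [ u ]≔ j) f
  cost-lower {S} {c} {f} {u} {j} u∈S cu≡1+j fu≤2 = +-cancelʳ-≡ (price j (f u)) _ _ (begin
    cost S c f + price j (f u)                  ≡⟨ cong (cost S c f +_) (term-at-u c′ (updateAt-updates u c)) ⟨
    cost S c f + term c′ u                      ≡⟨ sum-agree-off u c≗c′-off-u ⟩
    term c u + cost S c′ f                      ≡⟨ cong (_+ cost S c′ f) (term-at-u c cu≡1+j) ⟩
    price (suc j) (f u) + cost S c′ f           ≡⟨ cong (_+ cost S c′ f) (price-suc j (f u) fu≤2) ⟩
    bit (isTwo (f u)) + price j (f u) + cost S c′ f  ≡⟨ xy∙z≈xz∙y (bit (isTwo (f u))) _ _ ⟩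
    bit (isTwo (f u)) + cost S c′ f + price j (f u)  ∎)
    where
    open ≡-Reasoning
    c′ : Fin n → ℕ
    c′ = c [ u ]≔ j
    term : (Fin n → ℕ) → Fin n → ℕ
    term κ z = if S z then price (κ z) (f z) else 0
    term-at-u : ∀ κ {k} → κ u ≡ k → term κ u ≡ price k (f u)
    term-at-u κ κu≡k = cong₂ (λ b x → if b then price x (f u) else 0) (Equivalence.to T-≡ u∈S) κu≡k
    c≗c′-off-u : ∀ z → z ≢ u → term c z ≡ term c′ z
    c≗c′-off-u z z≢u = cong (λ x → if S z then price x (f z) else 0) (sym (updateAt-minimal z u c z≢u))

  module Insert {S : Fin n → Bool} {v : Fin n} (v∈S : T (S v)) where

    S⁻ : Fin n → Bool
    S⁻ = S [ v ]≔ false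

    S⇒S⁻ : ∀ {z} → T (S z) → z ≢ v → T (S⁻ z)
    S⇒S⁻ {z} z∈S z≢v = subst T (sym (updateAt-minimal z v S z≢v)) z∈S

    S⁻⇒S : ∀ {z} → T (S⁻ z) → T (S z) × z ≢ v
    S⁻⇒S {z} z∈S⁻ with z ≟ v
    ... | yes refl = ⊥-elim (subst T (updateAt-updates v S) z∈S⁻)
    ... | no z≢v   = subst T (updateAt-minimal z v S z≢v) z∈S⁻ , z≢v

    ∣∣-split : ∀ {P Q} → Q v ≡ false → (∀ z → z ≢ v → P z ≡ Q z) → ∣ P ∣ ≡ bit (P v) + ∣ Q ∣
    ∣∣-split Qv≡false P≗Q = sum-split v (cong bit Qv≡false) λ z z≢v → cong bit (P≗Q z z≢v)

    size-S⁻ : ∣ S ∣ ≡ suc ∣ S⁻ ∣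
    size-S⁻ = trans (∣∣-split (updateAt-updates v S) λ z z≢v → sym (updateAt-minimal z v S z≢v))
                    (cong (λ x → bit x + ∣ S⁻ ∣) (Equivalence.to T-≡ v∈S))

    size-insert : ∀ {A} b → A v ≡ false → ∣ A [ v ]≔ b ∣ ≡ bit b + ∣ A ∣
    size-insert {A} b Av≡false =
      trans (∣∣-split Av≡false λ z z≢v → updateAt-minimal z v A z≢v)
            (cong (λ x → bit x + ∣ A ∣) (updateAt-updates v A))

    nbhd-insert : ∀ {A} b → A v ≡ false → ∀ w →
                  ∣ N[ w ]∩ (A [ v ]≔ b) ∣ ≡ bit (inN G w v ∧ b) + ∣ N[ w ]∩ A ∣
    nbhd-insert {A} b Av≡false w =
      trans (∣∣-split (trans (cong (inN G w v ∧_) Av≡false) (∧-zeroʳ (inN G w v)))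
                      λ z z≢v → cong (inN G w z ∧_) (updateAt-minimal z v A z≢v))
            (cong (λ x → bit (inN G w v ∧ x) + ∣ N[ w ]∩ A ∣) (updateAt-updates v A))

    cost-insert : ∀ {c f} x → cost S c (f [ v ]≔ x) ≡ price (c v) x + cost S⁻ c f
    cost-insert {c} {f} x =
      trans (sum-split v (cong (λ b → if b then price (c v) (f v) else 0) (updateAt-updates v S))
                        λ z z≢v → cong₂ (λ b y → if b then price (c z) y else 0)
                                        (sym (updateAt-minimal z v S z≢v)) (updateAt-minimal z v f z≢v))
            (cong (_+ cost S⁻ c f) (cong₂ (λ b y → if b then price (c v) y else 0)
                                          (Equivalence.to T-≡ v∈S) (updateAt-updates v f)))

    v∉A : ∀ {d c A} → Packing S⁻ d c A → A v ≡ false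
    v∉A packing = ¬T⇒≡false λ Av → proj₂ (S⁻⇒S (proj₁ (Packing.demanded packing v Av))) refl

    record Extension {d d′ : Fin n → Bool} {c c′ : Fin n → ℕ} (σ : TightPair S⁻ d′ c′) : Set where
      open TightPair σ
      field
        label             : ℕ
        pick              : Bool
        label≤2           : label ≤ 2
        v-dominated       : T (d v) → label ≡ 0 → ∃ λ u → T (S⁻ u) × Adj G v u × f u ≡ 2
        dropped-dominated : ∀ w → T (S⁻ w) → T (d w) → ¬ T (d′ w) → f w ≡ 0 → Adj G w v × label ≡ 2
        demand⊆           : ∀ w → T (d′ w) → T (d w)
        pick-demanded     : T pick → T (d v)
        v-within          : bit pick + ∣ N[ v ]∩ A ∣ ≤ c v
        capacity-shift    : ∀ w → T (S⁻ w) → bit (adj w v ∧ pick) + c′ w ≤ c w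
        cost-step         : price (c v) label + cost S⁻ c f ≤ cost S⁻ c′ f + bit pick

    module Extended {d d′ c c′} {σ : TightPair S⁻ d′ c′} (E : Extension {d} {d′} {c} {c′} σ) where
      open TightPair σ renaming (f to f′; A to A′; cover to cover′; packing to packing′; tight to tight′)
      open Extension E

      f : Fin n → ℕ
      f = f′ [ v ]≔ label

      A : Fin n → Bool
      A = A′ [ v ]≔ pick

      f≡f′ : ∀ {z} → z ≢ v → f z ≡ f′ z
      f≡f′ {z} = updateAt-minimal z v f′

      lift : ∀ {w} → (∃ λ u → T (S⁻ u) × Adj G w u × f′ u ≡ 2) →
                      ∃ λ u → T (S u) × Adj G w u × f u ≡ 2
      lift (u , u∈S⁻ , wu , f′u≡2) =
        let u∈S , u≢v = S⁻⇒S u∈S⁻ in u , u∈S , wu , trans (f≡f′ u≢v) f′u≡2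

      bounded : ∀ z → f z ≤ 2
      bounded z with z ≟ v
      ... | yes refl = subst (_≤ 2) (sym (updateAt-updates v f′)) label≤2
      ... | no z≢v   = subst (_≤ 2) (sym (f≡f′ z≢v)) (Cover.bounded cover′ z)

      dominated : ∀ w → T (S w) → T (d w) → f w ≡ 0 → ∃ λ u → T (S u) × Adj G w u × f u ≡ 2
      dominated w w∈S dw fw≡0 with w ≟ v
      ... | yes refl = lift (v-dominated dw (trans (sym (updateAt-updates v f′)) fw≡0))
      ... | no w≢v with T? (d′ w) | trans (sym (f≡f′ w≢v)) fw≡0
      ...   | yes d′w | f′w≡0 = lift (Cover.dominated cover′ w (S⇒S⁻ w∈S w≢v) d′w f′w≡0)
      ...   | no ¬d′w | f′w≡0 =
        let wv , label≡2 = dropped-dominated w (S⇒S⁻ w∈S w≢v) dw ¬d′w f′w≡0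
        in v , v∈S , wv , trans (updateAt-updates v f′) label≡2

      A′v≡false : A′ v ≡ false
      A′v≡false = v∉A packing′

      demanded : ∀ z → T (A z) → T (S z) × T (d z)
      demanded z Az with z ≟ v
      ... | yes refl = v∈S , pick-demanded (subst T (updateAt-updates v A′) Az)
      ... | no z≢v   =
        let z∈S⁻ , d′z = Packing.demanded packing′ z (subst T (updateAt-minimal z v A′ z≢v) Az)
        in proj₁ (S⁻⇒S z∈S⁻) , demand⊆ z d′z

      within : ∀ w → T (S w) → ∣ N[ w ]∩ A ∣ ≤ c w
      within w w∈S with w ≟ v
      ... | yes refl = begin
        ∣ N[ v ]∩ A ∣                             ≡⟨ nbhd-insert pick A′v≡false v ⟩
        bit (inN G v v ∧ pick) + ∣ N[ v ]∩ A′ ∣   ≡⟨ cong (λ b → bit (b ∧ pick) + ∣ N[ v ]∩ A′ ∣) (inN-refl v) ⟩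
        bit pick + ∣ N[ v ]∩ A′ ∣                 ≤⟨ v-within ⟩
        c v                                       ∎
        where open ≤-Reasoning
      ... | no w≢v = begin
        ∣ N[ w ]∩ A ∣                             ≡⟨ nbhd-insert pick A′v≡false w ⟩
        bit (inN G w v ∧ pick) + ∣ N[ w ]∩ A′ ∣   ≡⟨ cong (λ b → bit (b ∧ pick) + ∣ N[ w ]∩ A′ ∣) (inN-≢ w≢v) ⟩
        bit (adj w v ∧ pick) + ∣ N[ w ]∩ A′ ∣     ≤⟨ +-monoʳ-≤ (bit (adj w v ∧ pick)) (Packing.within packing′ w w∈S⁻) ⟩
        bit (adj w v ∧ pick) + c′ w               ≤⟨ capacity-shift w w∈S⁻ ⟩
        c w                                       ∎
        where
        open ≤-Reasoning
        w∈S⁻ : T (S⁻ w)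
        w∈S⁻ = S⇒S⁻ w∈S w≢v

      tight : cost S c f ≤ ∣ A ∣
      tight = begin
        cost S c f                        ≡⟨ cost-insert label ⟩
        price (c v) label + cost S⁻ c f′  ≤⟨ cost-step ⟩
        cost S⁻ c′ f′ + bit pick          ≤⟨ +-monoˡ-≤ (bit pick) tight′ ⟩
        ∣ A′ ∣ + bit pick                 ≡⟨ +-comm ∣ A′ ∣ (bit pick) ⟩
        bit pick + ∣ A′ ∣                 ≡⟨ size-insert pick A′v≡false ⟨
        ∣ A ∣                             ∎
        where open ≤-Reasoning

    extend : ∀ {d d′ c c′} {σ : TightPair S⁻ d′ c′} → Extension {d} {d′} {c} {c′} σ → TightPair S d c
    extend E = record
      { f       = f
      ; A       = A
      ; cover   = record { bounded = bounded ; dominated = dominated }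
      ; packing = record { demanded = demanded ; within = within }
      ; tight   = tight
      }
      where open Extended E

    A⊆S : ∀ {d c A} → Packing S⁻ d c A → ∀ z → T (A z) → T (S z)
    A⊆S packing z Az = proj₁ (S⁻⇒S (proj₁ (Packing.demanded packing z Az)))

    nbhd-∖N : ∀ {d c A} → Packing S⁻ (d ∖N v) c A → ∣ N[ v ]∩ A ∣ ≡ 0
    nbhd-∖N {d} packing = nbhd-empty (v∉A packing) λ z Az → ∖N-¬Adj {d} (proj₂ (Packing.demanded packing z Az))

    nbhd-isolated : ∀ {d c A} → (∀ w → T (S w) → ¬ Adj G v w) → Packing S⁻ d c A → ∣ N[ v ]∩ A ∣ ≡ 0
    nbhd-isolated none packing = nbhd-empty (v∉A packing) λ z Az → none z (A⊆S packing z Az)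

    nbhd-pendant : ∀ {d c A} → Pendant S v → Packing S⁻ d c A → ∣ N[ v ]∩ A ∣ ≤ 1
    nbhd-pendant (isolated none)  packing = subst (_≤ 1) (sym (nbhd-isolated none packing)) z≤n
    nbhd-pendant (leaf _ _ only-u) packing = nbhd-single (v∉A packing) λ z Az → only-u z (A⊆S packing z Az)

    unpicked-capacity : ∀ {c : Fin n → ℕ} w → T (S⁻ w) → bit (adj w v ∧ false) + c w ≤ c w
    unpicked-capacity {c} w _ = ≤-reflexive (cong (λ b → bit b + c w) (∧-zeroʳ (adj w v)))

    -- Label 2 is free at v and dominates its neighbours, so v need not be pendant.
    remove-free : ∀ {d c} → c v ≡ 0 → TightPair S⁻ (d ∖N v) c → TightPair S d c
    remove-free {d} {c} cv≡0 σ = extend {σ = σ} record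
      { label             = 2
      ; pick              = false
      ; label≤2           = ≤-refl
      ; v-dominated       = λ _ ()
      ; dropped-dominated = λ w _ dw ¬d′w _ → Adj-sym (∖N-dropped {d} dw ¬d′w) , refl
      ; demand⊆           = λ w → ∖N-⊆ {d}
      ; pick-demanded     = λ ()
      ; v-within          = ≤-reflexive (trans (nbhd-∖N packing) (sym cv≡0))
      ; capacity-shift    = unpicked-capacity {c}
      ; cost-step         = ≤-reflexive (trans (cong (λ x → price x 2 + cost S⁻ c f) cv≡0)
                                               (sym (+-identityʳ (cost S⁻ c f))))
      }
      where open TightPair σ

    remove-undemanded : ∀ {d c} → Pendant S v → ¬ T (d v) → 1 ≤ c v → TightPair S⁻ d c → TightPair S d c
    remove-undemanded {d} {c} pendant ¬dv 1≤cv σ = extend {σ = σ} record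
      { label             = 0
      ; pick              = false
      ; label≤2           = z≤n
      ; v-dominated       = λ dv → contradiction dv ¬dv
      ; dropped-dominated = λ _ _ dw ¬dw → contradiction dw ¬dw
      ; demand⊆           = λ _ dw → dw
      ; pick-demanded     = λ ()
      ; v-within          = ≤-trans (nbhd-pendant pendant (TightPair.packing σ)) 1≤cv
      ; capacity-shift    = unpicked-capacity {c}
      ; cost-step         = ≤-reflexive (sym (+-identityʳ _))
      }

    remove-isolated : ∀ {d c} → (∀ w → T (S w) → ¬ Adj G v w) → T (d v) → 1 ≤ c v →
                      TightPair S⁻ d c → TightPair S d c
    remove-isolated {d} {c} none dv 1≤cv σ = extend {σ = σ} record
      { label             = 1
      ; pick              = true
      ; label≤2           = s≤s z≤n
      ; v-dominated       = λ _ ()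
      ; dropped-dominated = λ _ _ dw ¬dw → contradiction dw ¬dw
      ; demand⊆           = λ _ dw → dw
      ; pick-demanded     = λ _ → dv
      ; v-within          = subst (λ k → 1 + k ≤ c v) (sym (nbhd-isolated none packing))
                                  (subst (_≤ c v) (sym (+-identityʳ 1)) 1≤cv)
      ; capacity-shift    = λ w w∈S⁻ → ≤-reflexive (cong (λ b → bit (b ∧ true) + c w) (no-edge w w∈S⁻))
      ; cost-step         = ≤-reflexive (+-comm 1 _)
      }
      where
      open TightPair σ
      no-edge : ∀ w → T (S⁻ w) → adj w v ≡ false
      no-edge w w∈S⁻ = ¬T⇒≡false λ wv → none w (proj₁ (S⁻⇒S w∈S⁻)) (Adj-sym wv)

    module Leaf {u} (u∈S : T (S u)) (vu : Adj G v u) (only-u : ∀ w → T (S w) → Adj G v w → w ≡ u) where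

      u∈S⁻ : T (S⁻ u)
      u∈S⁻ = S⇒S⁻ u∈S (Adj⇒≢ vu ∘ sym)

      lowered-capacity : ∀ {c j} → c u ≡ suc j → ∀ w → T (S⁻ w) → bit (adj w v ∧ true) + (c [ u ]≔ j) w ≤ c w
      lowered-capacity {c} {j} cu≡1+j w w∈S⁻ with w ≟ u
      ... | yes refl = ≤-reflexive (trans (cong₂ (λ b x → bit (b ∧ true) + x)
                                                 (Equivalence.to T-≡ (Adj-sym vu)) (updateAt-updates u c))
                                          (sym cu≡1+j))
      ... | no w≢u   = ≤-reflexive (cong₂ (λ b x → bit (b ∧ true) + x) no-edge (updateAt-minimal w u c w≢u))
        where
        no-edge : adj w v ≡ false
        no-edge = ¬T⇒≡false λ wv → w≢u (only-u w (proj₁ (S⁻⇒S w∈S⁻)) (Adj-sym wv))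

      lowered-cost : ∀ {c j f} → c u ≡ suc j → f u ≤ 2 → ∀ {b} → isTwo (f u) ≡ b →
                     cost S⁻ c f ≡ bit b + cost S⁻ (c [ u ]≔ j) f
      lowered-cost {c} {j} {f} cu≡1+j fu≤2 refl = cost-lower {S⁻} {c} {f} u∈S⁻ cu≡1+j fu≤2

      -- A demanded leaf v joins the packing against one unit of u's capacity: that unit pays for
      -- u's label if it is 2, and otherwise v pays 1 for its own label (1, or 2 when c v = 1 has
      -- forced u out of the demand set and v must dominate it).
      remove-tight : ∀ {d c j} → T (d v) → c v ≡ 1 → c u ≡ suc j →
                     TightPair S⁻ (d ∖N v) (c [ u ]≔ j) → TightPair S d c
      remove-tight {d} {c} {j} dv cv≡1 cu≡1+j σ = by-label-of-u (isTwo (f u)) refl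
        where
        open TightPair σ
        v-within : 1 + ∣ N[ v ]∩ A ∣ ≤ c v
        v-within = ≤-reflexive (trans (cong (1 +_) (nbhd-∖N packing)) (sym cv≡1))
        by-label-of-u : ∀ b → isTwo (f u) ≡ b → TightPair S d c
        by-label-of-u true two = extend {σ = σ} record
          { label             = 0
          ; pick              = true
          ; label≤2           = z≤n
          ; v-dominated       = λ _ _ → u , u∈S⁻ , vu , isTwo⇒≡2 two
          ; dropped-dominated = λ w w∈S⁻ dw ¬d′w fw≡0 →
              let w≡u = only-u w (proj₁ (S⁻⇒S w∈S⁻)) (∖N-dropped {d} dw ¬d′w)
              in contradiction (trans (sym (isTwo⇒≡2 two)) (subst (λ x → f x ≡ 0) w≡u fw≡0)) λ ()
          ; demand⊆           = λ w → ∖N-⊆ {d}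
          ; pick-demanded     = λ _ → dv
          ; v-within          = v-within
          ; capacity-shift    = lowered-capacity cu≡1+j
          ; cost-step         = ≤-reflexive (trans (lowered-cost cu≡1+j (Cover.bounded cover u) two) (+-comm 1 _))
          }
        by-label-of-u false two = extend {σ = σ} record
          { label             = 2
          ; pick              = true
          ; label≤2           = ≤-refl
          ; v-dominated       = λ _ ()
          ; dropped-dominated = λ w _ dw ¬d′w _ → Adj-sym (∖N-dropped {d} dw ¬d′w) , refl
          ; demand⊆           = λ w → ∖N-⊆ {d}
          ; pick-demanded     = λ _ → dv
          ; v-within          = v-within
          ; capacity-shift    = lowered-capacity cu≡1+j
          ; cost-step         = ≤-reflexive (trans (cong₂ _+_ cv≡1 (lowered-cost cu≡1+j (Cover.bounded cover u) two))
                                                   (+-comm 1 _))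
          }

      remove-loose : ∀ {d c j k} → T (d v) → c v ≡ suc (suc k) → c u ≡ suc j →
                     TightPair S⁻ d (c [ u ]≔ j) → TightPair S d c
      remove-loose {d} {c} {j} dv cv≡2+k cu≡1+j σ = by-label-of-u (isTwo (f u)) refl
        where
        open TightPair σ
        v-within : 1 + ∣ N[ v ]∩ A ∣ ≤ c v
        v-within = ≤-trans (+-monoʳ-≤ 1 (nbhd-pendant (leaf u∈S vu only-u) packing))
                           (subst (2 ≤_) (sym cv≡2+k) (s≤s (s≤s z≤n)))
        by-label-of-u : ∀ b → isTwo (f u) ≡ b → TightPair S d c
        by-label-of-u true two = extend {σ = σ} record
          { label             = 0
          ; pick              = true
          ; label≤2           = z≤n
          ; v-dominated       = λ _ _ → u , u∈S⁻ , vu , isTwo⇒≡2 two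
          ; dropped-dominated = λ _ _ dw ¬dw → contradiction dw ¬dw
          ; demand⊆           = λ _ dw → dw
          ; pick-demanded     = λ _ → dv
          ; v-within          = v-within
          ; capacity-shift    = lowered-capacity cu≡1+j
          ; cost-step         = ≤-reflexive (trans (lowered-cost cu≡1+j (Cover.bounded cover u) two) (+-comm 1 _))
          }
        by-label-of-u false two = extend {σ = σ} record
          { label             = 1
          ; pick              = true
          ; label≤2           = s≤s z≤n
          ; v-dominated       = λ _ ()
          ; dropped-dominated = λ _ _ dw ¬dw → contradiction dw ¬dw
          ; demand⊆           = λ _ dw → dw
          ; pick-demanded     = λ _ → dv
          ; v-within          = v-within
          ; capacity-shift    = lowered-capacity cu≡1+j
          ; cost-step         = ≤-reflexive (trans (cong (1 +_) (lowered-cost cu≡1+j (Cover.bounded cover u) two))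
                                                   (+-comm 1 _))
          }

  open Insert using (remove-free; remove-undemanded; remove-isolated; size-S⁻; module Leaf)

  remove-pendant : ∀ {S v} → T (S v) → Pendant S v →
                   (∀ {x} → T (S x) → ∀ d c → TightPair (S [ x ]≔ false) d c) →
                   ∀ d c → TightPair S d c
  remove-pendant {S} {v} v∈S pendant IH d c with c v in cv
  ... | zero = remove-free v∈S cv (IH v∈S (d ∖N v) c)
  ... | suc m with T? (d v) | pendant | subst (1 ≤_) (sym cv) (s≤s z≤n)
  ...   | no ¬dv | _                      | 1≤cv = remove-undemanded v∈S pendant ¬dv 1≤cv (IH v∈S d c)
  ...   | yes dv | isolated none          | 1≤cv = remove-isolated v∈S none dv 1≤cv (IH v∈S d c)
  ...   | yes dv | leaf {u} u∈S vu only-u | _ with c u in cu | m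
  ...     | zero  | _     = remove-free u∈S cu (IH u∈S (d ∖N u) c)
  ...     | suc j | zero  = Leaf.remove-tight v∈S u∈S vu only-u dv cv cu (IH v∈S (d ∖N v) (c [ u ]≔ j))
  ...     | suc j | suc _ = Leaf.remove-loose v∈S u∈S vu only-u dv cv cu (IH v∈S d (c [ u ]≔ j))

  acyclic⇒tight-pair : Acyclic G → ∀ k {S} → ∣ S ∣ ≡ k → ∀ d c → TightPair S d c
  acyclic⇒tight-pair acyclic k {S} ∣S∣≡k with any? (λ s → T? (S s))
  ... | no S-empty = λ _ _ → empty-pair λ s s∈S → S-empty (s , s∈S)
  ... | yes (s , s∈S) with k
  ...   | zero  = contradiction (trans (sym (size-S⁻ s∈S)) ∣S∣≡k) λ ()
  ...   | suc k =
    let v , v∈S , pendant = pendant-exists acyclic s∈S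
    in remove-pendant v∈S pendant λ x∈S →
         acyclic⇒tight-pair acyclic k (suc-injective (trans (sym (size-S⁻ x∈S)) ∣S∣≡k))

  acyclic⇒duality : Acyclic G → ∃₂ λ f A → IsRDF G f × IsTwoNeighbourPacking G A × weight G f ≤ size G A
  acyclic⇒duality acyclic = f , A , rdf , packing₂ , weight≤size
    where
    open TightPair (acyclic⇒tight-pair acyclic _ refl (const true) (const 2))
    rdf : IsRDF G f
    rdf = Cover.bounded cover , λ v fv≡0 →
      let u , _ , vu , fu≡2 = Cover.dominated cover v _ _ fv≡0 in u , vu , fu≡2
    packing₂ : IsTwoNeighbourPacking G A
    packing₂ v = subst (_≤ 2) (sym (count≡sum G _)) (Packing.within packing v _)
    weight≤size : weight G f ≤ size G A
    weight≤size = subst₂ _≤_ (trans (sum-cong-≗ λ z → price-2 (Cover.bounded cover z)) (sym (sumV≡sum G f)))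
                             (sym (count≡sum G A)) tight
      where
      price-2 : ∀ {k} → k ≤ 2 → price 2 k ≡ k
      price-2 {0} _ = refl
      price-2 {1} _ = refl
      price-2 {2} _ = refl
      price-2 {suc (suc (suc _))} (s≤s (s≤s ()))

mainTheorem1 : (n : ℕ) (T : Graph n) → IsTree T →
    ∃ λ k → RomanDominationNumber T k × TwoNeighbourPackingNumber T k
mainTheorem1 n G (_ , _ , acyclic) with acyclic⇒duality G acyclic
... | f , A , rdf , packing , weight≤size =
  weight G f ,
  ((f , rdf , refl) , λ g rdf-g → ≤-trans weight≤size (packing≤weight G rdf-g packing)) ,
  ((A , packing , ≤-antisym (packing≤weight G rdf packing) weight≤size) ,
   λ B packing-B → packing≤weight G rdf packing-B)
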